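{- Let $\mathcal{C}=\{c_1,\ldots,c_m\}$ be a collection of cliques with graph union $U$ on vertex set $V$, and let $S(G)=\{J\subseteq\{1,\ldots,m\}:\Gamma_J\neq\emptyset\}$. If $\mathcal{F}\subseteq S(G)$ is a nonempty intersecting family, then the subgraph $H_{\mathcal{F}}$ of $U$ induced by $\bigcup_{J\in\mathcal{F}}\Gamma_J$ is a clique. Furthermore, $\mathcal{F}$ is a maximal intersecting family on $S(G)$ (i.e. no intersecting family $\mathcal{F}'$ with $\mathcal{F}\subsetneq\mathcal{F}'\subseteq S(G)$ exists) if and only if $H_{\mathcal{F}}$ is a maximal clique of $U$.
   Context: A clique is identified with its vertex set. The graph union $U$ of $c_1,\ldots,c_m$ has vertex set $V=\bigcup_j c_j$, and distinct $u,v\in V$ are adjacent iff $u,v\in c_j$ for some $j$. For $J\subseteq\{1,\ldots,m\}$, $\Gamma_J$ is the set of $v\in V$ with $\{j:v\in c_j\}=J$. A family of sets is intersecting if any two distinct members have nonempty intersection. -}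

module Defs where

open import Data.Nat using (ℕ)
open import Data.Fin using (Fin)
open import Data.Fin.Subset using (Subset; _∈_; _∉_; _∩_)
open import Data.Product using (Σ; ∃; ∃-syntax; _×_)
open import Data.Empty using (⊥)
open import Relation.Nullary using (¬_)
open import Relation.Binary.PropositionalEquality using (_≡_; _≢_)
open import Function.Bundles using (_⇔_)
open import Level using (0ℓ)
open import Relation.Unary using (Pred)

-- A collection of m cliques c₁,…,cₘ, each a set of vertices drawn from Fin n.
Cliques : ℕ → ℕ → Set
Cliques m n = Fin m → Subset n

module _ {m n : ℕ} (c : Cliques m n) where

  InV : Fin n → Set
  InV v = ∃[ j ] (v ∈ c j)

  Adj : Fin n → Fin n → Set
  Adj u v = (u ≢ v) × ∃[ j ] (u ∈ c j × v ∈ c j)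

  Γ : Subset m → Fin n → Set
  Γ J v = InV v × (∀ j → (v ∈ c j) ⇔ (j ∈ J))

  InS : Subset m → Set
  InS J = ∃[ v ] Γ J v

  -- a clique of U (identified with its vertex set W ⊆ V)
  IsClique : Pred (Fin n) 0ℓ → Set
  IsClique W = (∀ v → W v → InV v) × (∀ u v → W u → W v → u ≢ v → Adj u v)

  StrictSub : Pred (Fin n) 0ℓ → Pred (Fin n) 0ℓ → Set
  StrictSub W W' = (∀ v → W v → W' v) × ∃[ v ] (W' v × ¬ W v)

  IsMaximalClique : Pred (Fin n) 0ℓ → Set₁
  IsMaximalClique W = IsClique W × (∀ W' → IsClique W' → ¬ StrictSub W W')

  HF : Pred (Subset m) 0ℓ → Pred (Fin n) 0ℓ
  HF F v = ∃[ J ] (F J × Γ J v)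

  FamilyOnS : Pred (Subset m) 0ℓ → Set
  FamilyOnS F = ∀ J → F J → InS J

Intersecting : {m : ℕ} → Pred (Subset m) 0ℓ → Set
Intersecting F = ∀ J J' → F J → F J' → J ≢ J' → ∃[ i ] (i ∈ (J ∩ J'))

NonemptyFamily : {m : ℕ} → Pred (Subset m) 0ℓ → Set
NonemptyFamily F = ∃[ J ] F J

StrictSubFamily : {m : ℕ} → Pred (Subset m) 0ℓ → Pred (Subset m) 0ℓ → Set
StrictSubFamily F F' = (∀ J → F J → F' J) × ∃[ J ] (F' J × ¬ F J)

IsMaximalIntersectingOnS : {m n : ℕ} → Cliques m n → Pred (Subset m) 0ℓ → Set₁
IsMaximalIntersectingOnS c F =
  Intersecting F × FamilyOnS c F ×
  (∀ F' → Intersecting F' → FamilyOnS c F' → ¬ StrictSubFamily F F')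

-- Every vertex v of U lies in exactly one cell Γ_J, namely for J = {j : v ∈ cⱼ}, and
-- two vertices lie in a common clique cⱼ exactly when their cells meet (in j). Hence
-- H_F is a clique iff the members of F pairwise meet, which intersecting families do.
-- Enlarging F within S(G) adds vertices of new cells to H_F, and conversely a vertex v
-- adjacent to all of H_F lets one adjoin the cell of v to F, so maximality transfers.
{-# OPTIONS --safe #-}
module Submission where

open import Defs
open import Data.Nat using (ℕ)
open import Data.Fin using (Fin)
open import Data.Fin.Subset using (Subset; _∈_; _∩_; Nonempty)
open import Data.Fin.Subset.Properties using (_∈?_; ⊆-antisym; x∈p∩q⁺; x∈p∩q⁻)
open import Data.Vec using (tabulate)
open import Data.Vec.Properties using (≡-dec; lookup∘tabulate; lookup⇒[]=; []=⇒lookup)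
open import Data.Bool.Properties using (T-≡) renaming (_≟_ to _≟ᵇ_)
open import Data.Product using (Σ-syntax; ∃-syntax; _×_; _,_; proj₁; proj₂)
open import Data.Sum using (inj₁; inj₂)
open import Data.Empty using (⊥-elim)
open import Function.Bundles using (_⇔_; mk⇔; Equivalence)
open import Level using (Level; 0ℓ)
open import Relation.Unary using (Pred; Decidable; _∪_; ｛_｝)
open import Relation.Nullary using (¬_; yes; no; isYes)
open import Relation.Nullary.Decidable using (dec-true; isYes≗does; toWitness)
open import Relation.Binary.PropositionalEquality using (_≡_; refl; trans; sym; subst)

open Equivalence

private
  variable
    ℓ : Level
    m n : ℕ

decidable⇒∃-subset : ∀ {m} {P : Pred (Fin m) ℓ} → Decidable P →
  Σ[ J ∈ Subset m ] (∀ j → P j ⇔ j ∈ J)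
decidable⇒∃-subset {m = m} {P = P} P? = J , λ j → mk⇔ (P⇒∈ j) (∈⇒P j)
  where
  J : Subset m
  J = tabulate (λ j → isYes (P? j))

  P⇒∈ : ∀ j → P j → j ∈ J
  P⇒∈ j p = lookup⇒[]= j J
    (trans (lookup∘tabulate _ j) (trans (isYes≗does (P? j)) (dec-true (P? j) p)))

  ∈⇒P : ∀ j → j ∈ J → P j
  ∈⇒P j j∈J = toWitness {a? = P? j}
    (from T-≡ (trans (sym (lookup∘tabulate _ j)) ([]=⇒lookup j∈J)))

∩-nonempty-comm : {J J' : Subset m} → Nonempty (J ∩ J') → Nonempty (J' ∩ J)
∩-nonempty-comm {J = J} {J'} (i , i∈) = i , x∈p∩q⁺ (proj₂ (x∈p∩q⁻ J J' i∈) , proj₁ (x∈p∩q⁻ J J' i∈))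

Intersecting-∪-｛｝ : {F : Pred (Subset m) 0ℓ} {J₀ : Subset m} → Intersecting F →
  (∀ J → F J → Nonempty (J ∩ J₀)) → Intersecting (F ∪ ｛ J₀ ｝)
Intersecting-∪-｛｝ int meets J J' (inj₁ FJ) (inj₁ FJ') J≢J' = int J J' FJ FJ' J≢J'
Intersecting-∪-｛｝ int meets J _ (inj₁ FJ) (inj₂ refl) _ = meets J FJ
Intersecting-∪-｛｝ int meets _ J' (inj₂ refl) (inj₁ FJ') _ = ∩-nonempty-comm (meets J' FJ')
Intersecting-∪-｛｝ int meets _ _ (inj₂ refl) (inj₂ refl) J≢J = ⊥-elim (J≢J refl)

module _ (c : Cliques m n) where

  Γ-unique : ∀ {J J' v} → Γ c J v → Γ c J' v → J ≡ J'
  Γ-unique (_ , g) (_ , g') = ⊆-antisym (λ {j} j∈J → to (g' j) (from (g j) j∈J))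
                                        (λ {j} j∈J' → to (g j) (from (g' j) j∈J'))

  Γ-total : ∀ {v} → InV c v → ∃[ J ] Γ c J v
  Γ-total {v} v∈V = let J , v∈c⇔ = decidable⇒∃-subset (λ j → v ∈? c j) in J , v∈V , v∈c⇔

  common-clique⇒cells-meet : ∀ {J J' u v} → Γ c J u → Γ c J' v →
    ∃[ j ] (u ∈ c j × v ∈ c j) → Nonempty (J ∩ J')
  common-clique⇒cells-meet (_ , g) (_ , g') (j , u∈cⱼ , v∈cⱼ) = j , x∈p∩q⁺ (to (g j) u∈cⱼ , to (g' j) v∈cⱼ)

  cells-meet⇒common-clique : ∀ {J J' u v} → Γ c J u → Γ c J' v →
    Nonempty (J ∩ J') → ∃[ j ] (u ∈ c j × v ∈ c j)
  cells-meet⇒common-clique {J} {J'} (_ , g) (_ , g') (j , j∈J∩J') =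
    j , from (g j) (proj₁ (x∈p∩q⁻ J J' j∈J∩J')) , from (g' j) (proj₂ (x∈p∩q⁻ J J' j∈J∩J'))

  Γ-meets-itself : ∀ {J v} → Γ c J v → Nonempty (J ∩ J)
  Γ-meets-itself Γv@(v∈V , _) = common-clique⇒cells-meet Γv Γv (proj₁ v∈V , proj₂ v∈V , proj₂ v∈V)

  Intersecting⇒cells-meet : ∀ {F J J' u v} → Intersecting F → F J → F J' →
    Γ c J u → Γ c J' v → Nonempty (J ∩ J')
  Intersecting⇒cells-meet {J = J} {J'} int FJ FJ' Γu Γv with ≡-dec _≟ᵇ_ J J'
  ... | yes refl = Γ-meets-itself Γu
  ... | no J≢J' = int J J' FJ FJ' J≢J'

  HF-clique : ∀ {F} → Intersecting F → IsClique c (HF c F)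
  HF-clique int = (λ { v (_ , _ , v∈V , _) → v∈V }) ,
    λ { u v (J , FJ , Γu) (J' , FJ' , Γv) u≢v →
          u≢v , cells-meet⇒common-clique Γu Γv (Intersecting⇒cells-meet int FJ FJ' Γu Γv) }

  HF-mono : ∀ {F F'} → (∀ J → F J → F' J) → ∀ v → HF c F v → HF c F' v
  HF-mono F⊆F' v (J , FJ , Γv) = J , F⊆F' J FJ , Γv

  maximalIntersecting⇒maximalClique : ∀ {F} → IsMaximalIntersectingOnS c F →
    IsMaximalClique c (HF c F)
  maximalIntersecting⇒maximalClique {F} (int , onS , maximal) =
    HF-clique int , not-strictly-contained
    where
    not-strictly-contained : ∀ W → IsClique c W → ¬ StrictSub c (HF c F) W
    not-strictly-contained W (W∈V , W-adj) (HF⊆W , v , Wv , v∉HF) =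
      maximal (F ∪ ｛ Jᵥ ｝) (Intersecting-∪-｛｝ int meetsJᵥ) onS'
              ((λ _ → inj₁) , Jᵥ , inj₂ refl , λ FJᵥ → v∉HF (Jᵥ , FJᵥ , Γv))
      where
      Jᵥ = proj₁ (Γ-total (W∈V v Wv))
      Γv = proj₂ (Γ-total (W∈V v Wv))

      meetsJᵥ : ∀ J → F J → Nonempty (J ∩ Jᵥ)
      meetsJᵥ J FJ = let u , Γu = onS J FJ ; u∈HF = J , FJ , Γu in
        common-clique⇒cells-meet Γu Γv
          (proj₂ (W-adj u v (HF⊆W u u∈HF) Wv λ { refl → v∉HF u∈HF }))

      onS' : FamilyOnS c (F ∪ ｛ Jᵥ ｝)
      onS' J (inj₁ FJ) = onS J FJ
      onS' _ (inj₂ refl) = v , Γv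

  maximalClique⇒maximalIntersecting : ∀ {F} → Intersecting F → FamilyOnS c F →
    IsMaximalClique c (HF c F) → IsMaximalIntersectingOnS c F
  maximalClique⇒maximalIntersecting {F} int onS (_ , maximal) =
    int , onS , λ { F' int' onS' (F⊆F' , J , F'J , J∉F) →
      let v , Γv = onS' J F'J in
      maximal (HF c F') (HF-clique int')
        (HF-mono F⊆F' , v , (J , F'J , Γv) ,
         λ { (J' , FJ' , Γ'v) → J∉F (subst F (Γ-unique Γ'v Γv) FJ') }) }

proposition4p14 : {m n : ℕ} (c : Cliques m n) (F : Pred (Subset m) 0ℓ) →
    FamilyOnS c F → NonemptyFamily F → Intersecting F →
    IsClique c (HF c F) × (IsMaximalIntersectingOnS c F ⇔ IsMaximalClique c (HF c F))
proposition4p14 c F onS _ int =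
  HF-clique c int ,
  mk⇔ (maximalIntersecting⇒maximalClique c) (maximalClique⇒maximalIntersecting c int onS)
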